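{- For every $n\ge1$, the number of Dyck paths $D\in\mathcal{D}_n$ without centered tunnels equals the Fine number $F_n$.
   Context: $\mathcal{D}_n$ is the set of words in $u$ (step $(1,1)$) and $d$ (step $(1,-1)$) with $n$ of each such that every prefix has at least as many $u$'s as $d$'s. A tunnel of $D$ is a decomposition $D=AuBdC$ with $B$ a Dyck word (possibly empty); it is centered if $|A|=|C|$. The Fine numbers are defined by $F_1=0$, $F_2=1$ and $C_n=2F_n+F_{n-1}$ for $n\ge2$, where $C_n=\frac1{n+1}\binom{2n}{n}$ is the $n$-th Catalan number. -}

module Defs where

open import Data.Nat using (ℕ; zero; suc; _+_; _*_; _/_; _≤_)
open import Data.Nat.Combinatorics using (_C_)
open import Data.List using (List; []; _∷_; _++_; length)
open import Data.List.Relation.Unary.Unique.Propositional using (Unique)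
open import Data.List.Membership.Propositional using (_∈_)
open import Data.Product using (Σ; ∃; ∃-syntax; _×_)
open import Relation.Binary.PropositionalEquality using (_≡_)
open import Relation.Nullary using (¬_)
open import Function.Bundles using (_⇔_)

-- Steps: u = (1,1), d = (1,-1)
data Step : Set where
  u d : Step

Word : Set
Word = List Step

#u : Word → ℕ
#u []       = 0
#u (u ∷ w)  = suc (#u w)
#u (d ∷ w)  = #u w

#d : Word → ℕ
#d []       = 0
#d (u ∷ w)  = #d w
#d (d ∷ w)  = suc (#d w)

PrefixOK : Word → Set
PrefixOK w = ∀ p q → p ++ q ≡ w → #d p ≤ #u p

IsDyckOf : ℕ → Word → Set
IsDyckOf n w = #u w ≡ n × #d w ≡ n × PrefixOK w

IsDyck : Word → Set
IsDyck w = ∃[ k ] IsDyckOf k w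

HasCenteredTunnel : Word → Set
HasCenteredTunnel D =
  ∃[ A′ ] ∃[ B′ ] ∃[ C′ ] (D ≡ A′ ++ (u ∷ B′ ++ (d ∷ C′))) × IsDyck B′ × length A′ ≡ length C′

-- "the set S ⊆ Word has exactly k elements": an explicit duplicate-free
-- listing of its elements of length k
HasCard : (Word → Set) → ℕ → Set
HasCard S k = Σ (List Word) λ L → Unique L × (∀ w → (w ∈ L) ⇔ S w) × length L ≡ k

catalan : ℕ → ℕ
catalan n = ((2 * n) C n) / suc n

IsFine : (ℕ → ℕ) → Set
IsFine F = F 1 ≡ 0 × F 2 ≡ 1 × (∀ m → catalan (suc (suc m)) ≡ 2 * F (suc (suc m)) + F (suc m))

{-# OPTIONS --safe #-}
-- Let c n be the number of Dyck words of semilength n and g n the number of those without a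
-- centered tunnel (g 0 = 1).  Cutting a Dyck word at its first return to the axis gives
-- c (n + 1) = Σ c k · c (n - k).  The centered tunnels of a word are nested, so a word with
-- one has a unique outermost one A u B d C; then A ++ C is a tunnel-free Dyck word of
-- semilength |A| and B is a Dyck word, which gives c (n + 1) = g (n + 1) + Σ g k · c (n - k).
-- For the generating functions this reads C = 1 + x C² and C = G (1 + x C), hence
-- C + 1 = (2 + x) G, i.e. c (n + 1) = 2 g (n + 1) + g n: g satisfies the Fine recurrence.
-- The reflection principle identifies c n with the closed form catalan n.
module Submission where

open import Defs
open import Data.Fin using (Fin; zero; suc; toℕ; fromℕ<)
import Data.Fin.Properties as Fin
open import Data.List using (List; []; _∷_; _++_; _∷ʳ_; [_]; length; map; filter; take; drop; cartesianProduct)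
open import Data.List.Membership.Propositional using (_∈_)
open import Data.List.Membership.Propositional.Properties
  using (∈-map⁺; ∈-map⁻; ∈-++⁺ˡ; ∈-++⁺ʳ; ∈-++⁻; ∈-∃++; ∈-filter⁺; ∈-filter⁻;
         ∈-cartesianProduct⁺; ∈-cartesianProduct⁻)
open import Data.List.Properties
  using (∷-injective; ∷-injectiveˡ; ∷-injectiveʳ; ++-identityʳ; ++-assoc; ∷ʳ-++; length-++; length-map;
         length-take; length-drop; take++drop≡id)
open import Data.List.Relation.Binary.Subset.Propositional using (_⊆_)
import Data.List.Relation.Unary.All as All
import Data.List.Relation.Unary.All.Properties as All
open import Data.List.Relation.Unary.AllPairs using ([]; _∷_)
open import Data.List.Relation.Unary.Any using (here; there)
open import Data.List.Relation.Unary.Unique.Propositional using (Unique)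
import Data.List.Relation.Unary.Unique.Propositional.Properties as Unique
open import Data.Maybe using (Maybe; just; nothing; _>>=_)
open import Data.Maybe.Properties using (just-injective; ≡-dec)
open import Data.Nat using (ℕ; zero; suc; _+_; _*_; _∸_; _⊓_; _/_; _≤_; _<_; z≤n; s≤s)
open import Data.Nat.Combinatorics using (nCk+nC[k+1]≡[n+1]C[k+1]; nCk≡nC[n∸k]; nC1≡n) renaming (_C_ to _choose_)
open import Data.Nat.DivMod using (m*n/n≡m)
open import Data.Nat.Induction using (<-rec; <-wellFounded; Acc; acc)
open import Data.Nat.Properties
open import Algebra.Properties.CommutativeMonoid.Sum +-0-commutativeMonoid
  using (sum-syntax; sum⁺-syntax; sum-cong-≗; ∑-distrib-+; sum-replicate-zero)
open import Algebra.Properties.CommutativeSemigroup +-commutativeSemigroup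
  using (interchange; x∙yz≈y∙xz; x∙yz≈xz∙y)
open import Data.Product using (Σ; ∃; ∃₂; _×_; _,_; proj₁; proj₂; uncurry; map₁; map₂)
open import Data.Sum using (_⊎_; inj₁; inj₂) renaming (map to ⊎-map)
open import Function using (_∘_)
open import Function.Bundles using (_⇔_; mk⇔; Equivalence)
open import Function.Properties.Equivalence using () renaming (sym to ⇔-sym; trans to ⇔-trans)
open import Level using (0ℓ)
open import Relation.Binary.Definitions using (tri<; tri≈; tri>)
open import Relation.Binary.PropositionalEquality hiding ([_])
open import Relation.Nullary using (¬_; contradiction; Dec; yes; no; ¬?)
open import Relation.Nullary.Decidable using (map′; _×-dec_; _⊎-dec_)
open import Relation.Unary using (Pred; Decidable; ∅; ｛_｝; _∪_; _∩_; _⟨×⟩_)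

private variable
  A B : Set

-- Finite sets given by duplicate-free listings

-- Defs.HasCard for predicates on any type; on Word the two coincide definitionally.
HasCard′ : Pred A 0ℓ → ℕ → Set
HasCard′ {A} S k = Σ (List A) λ L → Unique L × (∀ x → (x ∈ L) ⇔ S x) × length L ≡ k

∈-++-∷⁻ : ∀ {x y : A} xs ys → x ∈ xs ++ y ∷ ys → x ≢ y → x ∈ xs ++ ys
∈-++-∷⁻ []       ys (here refl) x≢y = contradiction refl x≢y
∈-++-∷⁻ []       ys (there p)   x≢y = p
∈-++-∷⁻ (z ∷ xs) ys (here refl) x≢y = here refl
∈-++-∷⁻ (z ∷ xs) ys (there p)   x≢y = there (∈-++-∷⁻ xs ys p x≢y)

unique-⊆⇒length-≤ : {xs ys : List A} → Unique xs → xs ⊆ ys → length xs ≤ length ys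
unique-⊆⇒length-≤ {xs = []}     _          _   = z≤n
unique-⊆⇒length-≤ {xs = x ∷ xs} (x∉ ∷ uxs) sub with ∈-∃++ (sub (here refl))
... | ys₁ , ys₂ , refl rewrite length-++ ys₁ {x ∷ ys₂} | +-suc (length ys₁) (length ys₂) =
  s≤s (≤-trans (unique-⊆⇒length-≤ uxs λ p → ∈-++-∷⁻ ys₁ ys₂ (sub (there p)) (All.lookup x∉ p ∘ sym))
               (≤-reflexive (length-++ ys₁)))

module _ {S : Pred A 0ℓ} where
  open Equivalence

  HasCard′-unique : ∀ {a b} → HasCard′ S a → HasCard′ S b → a ≡ b
  HasCard′-unique (L , uL , L⇔S , refl) (M , uM , M⇔S , refl) =
    ≤-antisym (unique-⊆⇒length-≤ uL (λ {x} → from (M⇔S x) ∘ to (L⇔S x)))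
              (unique-⊆⇒length-≤ uM (λ {x} → from (L⇔S x) ∘ to (M⇔S x)))

  HasCard′-resp-⇔ : ∀ {T : Pred A 0ℓ} {k} → (∀ x → S x ⇔ T x) → HasCard′ S k → HasCard′ T k
  HasCard′-resp-⇔ S⇔T (L , uL , L⇔S , len) = L , uL , (λ x → ⇔-trans (L⇔S x) (S⇔T x)) , len

  HasCard′-∩ : ∀ {P : Pred A 0ℓ} {k} → Decidable P → HasCard′ S k → ∃ λ m → HasCard′ (S ∩ P) m
  HasCard′-∩ P? (L , uL , L⇔S , _) =
    length (filter P? L) , filter P? L , Unique.filter⁺ P? uL ,
    (λ x → mk⇔ (λ p → let x∈L , Px = ∈-filter⁻ P? p in to (L⇔S x) x∈L , Px)
               (λ (Sx , Px) → ∈-filter⁺ P? (from (L⇔S x) Sx) Px)) ,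
    refl

HasCard′-∅ : HasCard′ {A} ∅ 0
HasCard′-∅ = [] , [] , (λ x → mk⇔ (λ ()) (λ ())) , refl

HasCard′-｛｝ : (x : A) → HasCard′ ｛ x ｝ 1
HasCard′-｛｝ x =
  x ∷ [] , All.[] ∷ [] , (λ y → mk⇔ (λ { (here refl) → refl }) (λ { refl → here refl })) , refl

HasCard′-⊎ : ∀ {S T : Pred A 0ℓ} {a b} → (∀ {x} → S x → ¬ T x) →
             HasCard′ S a → HasCard′ T b → HasCard′ (S ∪ T) (a + b)
HasCard′-⊎ disjoint (L , uL , L⇔S , refl) (M , uM , M⇔T , refl) =
  L ++ M ,
  Unique.++⁺ uL uM (λ {x} (x∈L , x∈M) → disjoint (to (L⇔S x) x∈L) (to (M⇔T x) x∈M)) ,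
  (λ x → mk⇔ (λ p → ⊎-map (to (L⇔S x)) (to (M⇔T x)) (∈-++⁻ L p))
             (λ { (inj₁ Sx) → ∈-++⁺ˡ (from (L⇔S x) Sx) ; (inj₂ Tx) → ∈-++⁺ʳ L (from (M⇔T x) Tx) })) ,
  length-++ L
  where open Equivalence

Image : (A → B) → Pred A 0ℓ → Pred B 0ℓ
Image f S y = ∃ λ x → S x × f x ≡ y

map⁺-on : ∀ {f : A → B} {L} → (∀ {x y} → x ∈ L → y ∈ L → f x ≡ f y → x ≡ y) →
          Unique L → Unique (map f L)
map⁺-on _   []         = []
map⁺-on inj (x∉L ∷ uL) =
  All.map⁺ (All.tabulate λ y∈L fx≡fy → All.lookup x∉L y∈L (inj (here refl) (there y∈L) fx≡fy)) ∷
  map⁺-on (λ x∈L y∈L → inj (there x∈L) (there y∈L)) uL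

HasCard′-image : ∀ {S : Pred A 0ℓ} {k} (f : A → B) → (∀ {x y} → S x → S y → f x ≡ f y → x ≡ y) →
                 HasCard′ S k → HasCard′ (Image f S) k
HasCard′-image f inj (L , uL , L⇔S , len) =
  map f L ,
  map⁺-on (λ x∈L y∈L → inj (to (L⇔S _) x∈L) (to (L⇔S _) y∈L)) uL ,
  (λ y → mk⇔ (λ p → let x , x∈L , y≡fx = ∈-map⁻ f p in x , to (L⇔S x) x∈L , sym y≡fx)
             (λ { (x , Sx , refl) → ∈-map⁺ f (from (L⇔S x) Sx) })) ,
  trans (length-map f L) len
  where open Equivalence

length-cartesianProduct : (xs : List A) (ys : List B) → length (cartesianProduct xs ys) ≡ length xs * length ys
length-cartesianProduct []       ys = refl
length-cartesianProduct (x ∷ xs) ys =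
  trans (length-++ (map (x ,_) ys)) (cong₂ _+_ (length-map (x ,_) ys) (length-cartesianProduct xs ys))

HasCard′-× : ∀ {S : Pred A 0ℓ} {T : Pred B 0ℓ} {a b} →
             HasCard′ S a → HasCard′ T b → HasCard′ (S ⟨×⟩ T) (a * b)
HasCard′-× (L , uL , L⇔S , refl) (M , uM , M⇔T , refl) =
  cartesianProduct L M ,
  Unique.cartesianProduct⁺ uL uM ,
  (λ (x , y) → mk⇔ (λ p → let x∈L , y∈M = ∈-cartesianProduct⁻ L M p in
                           to (L⇔S x) x∈L , to (M⇔T y) y∈M)
                   (λ (Sx , Ty) → ∈-cartesianProduct⁺ (from (L⇔S x) Sx) (from (M⇔T y) Ty))) ,
  length-cartesianProduct L M
  where open Equivalence

HasCard′-⋃ : ∀ {m} {S : Fin m → Pred A 0ℓ} {a : Fin m → ℕ} →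
             (∀ i → HasCard′ (S i) (a i)) → (∀ {i j x} → S i x → S j x → i ≡ j) →
             HasCard′ (λ x → ∃ λ i → S i x) (∑[ i < m ] a i)
HasCard′-⋃ {m = zero}  _     _        = HasCard′-resp-⇔ (λ x → mk⇔ (λ ()) λ ()) HasCard′-∅
HasCard′-⋃ {m = suc m} cards disjoint =
  HasCard′-resp-⇔ (λ x → mk⇔ (λ { (inj₁ S₀x) → zero , S₀x ; (inj₂ (i , Sx)) → suc i , Sx })
                             (λ { (zero , S₀x) → inj₁ S₀x ; (suc i , Sx) → inj₂ (i , Sx) }))
    (HasCard′-⊎ (λ S₀x (_ , Sx) → Fin.0≢1+n (disjoint S₀x Sx))
                (cards zero)
                (HasCard′-⋃ (cards ∘ suc) (λ Six Sjx → Fin.suc-injective (disjoint Six Sjx))))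

-- Convolution of sequences

_⋆_ : (ℕ → ℕ) → (ℕ → ℕ) → ℕ → ℕ
(a ⋆ b) n = ∑[ i ≤ n ] (a (toℕ i) * b (n ∸ toℕ i))

∃-Fin⇔∃-≤ : ∀ {n} {P : ℕ → Set} → (∃ λ (i : Fin (suc n)) → P (toℕ i)) ⇔ (∃ λ k → k ≤ n × P k)
∃-Fin⇔∃-≤ {P = P} =
  mk⇔ (λ (i , Pi) → toℕ i , Fin.toℕ≤pred[n] i , Pi)
      (λ (k , k≤n , Pk) → fromℕ< (s≤s k≤n) , subst P (sym (Fin.toℕ-fromℕ< (s≤s k≤n))) Pk)

Convolution : (ℕ → A → A → A) → (X Y : ℕ → Pred A 0ℓ) → ℕ → Pred A 0ℓ
Convolution enc X Y n w = ∃ λ k → k ≤ n × Image (uncurry (enc k)) (X k ⟨×⟩ Y (n ∸ k)) w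

module _ {X Y : ℕ → Pred A 0ℓ} {a b : ℕ → ℕ} (enc : ℕ → A → A → A) (n : ℕ) where

  HasCard′-⋆ : (∀ k → HasCard′ (X k) (a k)) → (∀ k → HasCard′ (Y k) (b k)) →
               (∀ {k l x y x′ y′} → X k x → Y (n ∸ k) y → X l x′ → Y (n ∸ l) y′ →
                  enc k x y ≡ enc l x′ y′ → k ≡ l × x ≡ x′ × y ≡ y′) →
               HasCard′ (Convolution enc X Y n) ((a ⋆ b) n)
  HasCard′-⋆ X-card Y-card enc-injective =
    HasCard′-resp-⇔ (λ _ → ∃-Fin⇔∃-≤)
      (HasCard′-⋃ (λ i → HasCard′-image _ injective-on-block
                           (HasCard′-× (X-card (toℕ i)) (Y-card (n ∸ toℕ i))))
                  (λ (_ , (Xx , Yy) , eq) (_ , (Xx′ , Yy′) , eq′) →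
                     Fin.toℕ-injective (proj₁ (enc-injective Xx Yy Xx′ Yy′ (trans eq (sym eq′))))))
    where
    injective-on-block : ∀ {k p q} → (X k ⟨×⟩ Y (n ∸ k)) p → (X k ⟨×⟩ Y (n ∸ k)) q →
                         uncurry (enc k) p ≡ uncurry (enc k) q → p ≡ q
    injective-on-block (Xx , Yy) (Xx′ , Yy′) eq =
      let _ , x≡x′ , y≡y′ = enc-injective Xx Yy Xx′ Yy′ eq in cong₂ _,_ x≡x′ y≡y′

δ : ℕ → ℕ
δ zero    = 1
δ (suc _) = 0

shift : (ℕ → ℕ) → ℕ → ℕ
shift a zero    = 0
shift a (suc n) = a n

⋆-congˡ : ∀ a a′ b n → (∀ (i : Fin (suc n)) → a (toℕ i) ≡ a′ (toℕ i)) → (a ⋆ b) n ≡ (a′ ⋆ b) n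
⋆-congˡ a a′ b n eq = sum-cong-≗ {suc n} λ i → cong (_* b (n ∸ toℕ i)) (eq i)

⋆-distribʳ-+ : ∀ a a′ b n → ((λ k → a k + a′ k) ⋆ b) n ≡ (a ⋆ b) n + (a′ ⋆ b) n
⋆-distribʳ-+ a a′ b n =
  trans (sum-cong-≗ {suc n} λ i → *-distribʳ-+ (b (n ∸ toℕ i)) (a (toℕ i)) (a′ (toℕ i)))
        (∑-distrib-+ {suc n} (λ i → a (toℕ i) * b (n ∸ toℕ i)) (λ i → a′ (toℕ i) * b (n ∸ toℕ i)))

δ-⋆ : ∀ b n → (δ ⋆ b) n ≡ b n
δ-⋆ b n = trans (cong₂ _+_ (+-identityʳ (b n)) (sum-replicate-zero n)) (+-identityʳ (b n))

module _ {c g : ℕ → ℕ} (c₀ : c 0 ≡ 1) (g₀ : g 0 ≡ 1)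
         (c-rec : ∀ n → c (suc n) ≡ (c ⋆ c) n) (g-rec : ∀ n → c (suc n) ≡ g (suc n) + (g ⋆ c) n) where

  c≡g+shift[g]⋆c : ∀ n → c n ≡ g n + (shift g ⋆ c) n
  c≡g+shift[g]⋆c zero    = trans c₀ (cong (_+ 0) (sym g₀))
  c≡g+shift[g]⋆c (suc n) = g-rec n  -- (shift g ⋆ c) (suc n) unfolds to (g ⋆ c) n

  -- The power series identity C + 1 = (2 + x) G read coefficientwise (δ is the series 1 and
  -- shift multiplies by x): convolved with c, both sides give c (n + 1) + c n.
  c+δ≡2g+shift[g] : ∀ n → c n + δ n ≡ g n + g n + shift g n
  c+δ≡2g+shift[g] = <-rec _ step
    where
    step : ∀ n → (∀ {m} → m < n → c m + δ m ≡ g m + g m + shift g m) → c n + δ n ≡ g n + g n + shift g n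
    step zero    _  = trans (cong (_+ 1) c₀) (sym (trans (+-identityʳ _) (cong₂ _+_ g₀ g₀)))
    step (suc n) ih = begin
      c (suc n) + 0    ≡⟨ trans (+-identityʳ _) (g-rec n) ⟩
      g₁ + gc          ≡⟨ cong (g₁ +_) gc≡g₁+g₀ ⟩
      g₁ + (g₁ + g n)  ≡⟨ sym (+-assoc g₁ g₁ (g n)) ⟩
      g₁ + g₁ + g n    ∎
      where
      open ≡-Reasoning
      g₁  = g (suc n)
      gc  = (g ⋆ c) n
      xgc = (shift g ⋆ c) n
      convolved : c (suc n) + c n ≡ gc + gc + xgc
      convolved = begin
        c (suc n) + c n                        ≡⟨ cong₂ _+_ (c-rec n) (sym (δ-⋆ c n)) ⟩
        (c ⋆ c) n + (δ ⋆ c) n                  ≡⟨ sym (⋆-distribʳ-+ c δ c n) ⟩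
        ((λ k → c k + δ k) ⋆ c) n              ≡⟨ ⋆-congˡ (λ k → c k + δ k) (λ k → g k + g k + shift g k) c n
                                                           (λ i → ih (s≤s (Fin.toℕ≤pred[n] i))) ⟩
        ((λ k → g k + g k + shift g k) ⋆ c) n  ≡⟨ ⋆-distribʳ-+ (λ k → g k + g k) (shift g) c n ⟩
        ((λ k → g k + g k) ⋆ c) n + xgc        ≡⟨ cong (_+ xgc) (⋆-distribʳ-+ g g c n) ⟩
        gc + gc + xgc                          ∎
      gc≡g₁+g₀ : gc ≡ g₁ + g n
      gc≡g₁+g₀ = sym (+-cancelʳ-≡ (gc + xgc) (g₁ + g n) gc (begin
        (g₁ + g n) + (gc + xgc)  ≡⟨ interchange g₁ (g n) gc xgc ⟩
        (g₁ + gc) + (g n + xgc)  ≡⟨ cong₂ _+_ (sym (g-rec n)) (sym (c≡g+shift[g]⋆c n)) ⟩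
        c (suc n) + c n          ≡⟨ convolved ⟩
        gc + gc + xgc            ≡⟨ +-assoc gc gc xgc ⟩
        gc + (gc + xgc)          ∎))

  fine-recurrence : ∀ n → c (suc n) ≡ 2 * g (suc n) + g n
  fine-recurrence n = begin
    c (suc n)                    ≡⟨ sym (+-identityʳ _) ⟩
    c (suc n) + 0                ≡⟨ c+δ≡2g+shift[g] (suc n) ⟩
    g (suc n) + g (suc n) + g n  ≡⟨ cong (λ x → g (suc n) + x + g n) (sym (+-identityʳ _)) ⟩
    2 * g (suc n) + g n          ∎
    where open ≡-Reasoning

IsFine-unique : ∀ {F G} → IsFine F → IsFine G → ∀ n → F (suc n) ≡ G (suc n)
IsFine-unique         (F₁ , _ , _)          (G₁ , _ , _)          zero    = trans F₁ (sym G₁)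
IsFine-unique {F} {G} isF@(_ , _ , F-rec) isG@(_ , _ , G-rec) (suc n) =
  *-cancelˡ-≡ _ _ 2 (+-cancelʳ-≡ (F (suc n)) _ _ (begin
    2 * F (suc (suc n)) + F (suc n)  ≡⟨ sym (F-rec n) ⟩
    catalan (suc (suc n))            ≡⟨ G-rec n ⟩
    2 * G (suc (suc n)) + G (suc n)  ≡⟨ cong (2 * G (suc (suc n)) +_) (sym (IsFine-unique {F} {G} isF isG n)) ⟩
    2 * G (suc (suc n)) + F (suc n)  ∎))
  where open ≡-Reasoning

++-≡-++⁻ : ∀ (xs ys xs′ ys′ : List A) → xs ++ ys ≡ xs′ ++ ys′ → length xs ≤ length xs′ →
           ∃ λ zs → xs′ ≡ xs ++ zs × ys ≡ zs ++ ys′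
++-≡-++⁻ []       ys xs′        ys′ eq _         = xs′ , refl , eq
++-≡-++⁻ (x ∷ xs) ys (x′ ∷ xs′) ys′ eq (s≤s len) with refl , eq′ ← ∷-injective eq =
  let zs , xs′≡ , ys≡ = ++-≡-++⁻ xs ys xs′ ys′ eq′ len in zs , cong (x ∷_) xs′≡ , ys≡

++-≡-++⁻ʳ : ∀ (xs ys xs′ ys′ : List A) → xs ++ ys ≡ xs′ ++ ys′ → length ys ≤ length ys′ →
            ∃ λ zs → xs ≡ xs′ ++ zs × ys′ ≡ zs ++ ys
++-≡-++⁻ʳ xs ys xs′ ys′ eq ys≤ys′ =
  ++-≡-++⁻ xs′ ys′ xs ys (sym eq) (+-cancelʳ-≤ (length ys) _ _ (begin
    length xs′ + length ys   ≤⟨ +-monoʳ-≤ (length xs′) ys≤ys′ ⟩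
    length xs′ + length ys′  ≡⟨ sym (length-++ xs′) ⟩
    length (xs′ ++ ys′)      ≡⟨ cong length (sym eq) ⟩
    length (xs ++ ys)        ≡⟨ length-++ xs ⟩
    length xs + length ys    ∎))
  where open ≤-Reasoning

++-≡-++-same-length : ∀ (xs ys xs′ ys′ : List A) → xs ++ ys ≡ xs′ ++ ys′ → length xs ≡ length xs′ →
                      xs ≡ xs′ × ys ≡ ys′
++-≡-++-same-length []       ys []         ys′ eq _   = refl , eq
++-≡-++-same-length (x ∷ xs) ys (x′ ∷ xs′) ys′ eq len with refl , eq′ ← ∷-injective eq =
  map₁ (cong (x ∷_)) (++-≡-++-same-length xs ys xs′ ys′ eq′ (suc-injective len))

take-length-++ : ∀ (xs ys : List A) → take (length xs) (xs ++ ys) ≡ xs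
take-length-++ []       ys = refl
take-length-++ (x ∷ xs) ys = cong (x ∷_) (take-length-++ xs ys)

drop-length-++ : ∀ (xs ys : List A) → drop (length xs) (xs ++ ys) ≡ ys
drop-length-++ []       ys = refl
drop-length-++ (x ∷ xs) ys = drop-length-++ xs ys

splits? : {P : List A → List A → Set} → (∀ xs ys → Dec (P xs ys)) →
          ∀ zs → Dec (∃₂ λ xs ys → zs ≡ xs ++ ys × P xs ys)
splits?         P? []       =
  map′ (λ p → [] , [] , refl , p)
       (λ { ([] , [] , refl , p) → p ; ([] , _ ∷ _ , () , _) ; (_ ∷ _ , _ , () , _) })
       (P? [] [])
splits? {P = P} P? (z ∷ zs) = map′ join split (P? [] (z ∷ zs) ⊎-dec splits? (λ xs → P? (z ∷ xs)) zs)
  where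
  join : P [] (z ∷ zs) ⊎ (∃₂ λ xs ys → zs ≡ xs ++ ys × P (z ∷ xs) ys) →
         ∃₂ λ xs ys → z ∷ zs ≡ xs ++ ys × P xs ys
  join (inj₁ p)                  = [] , z ∷ zs , refl , p
  join (inj₂ (xs , ys , eq , p)) = z ∷ xs , ys , cong (z ∷_) eq , p
  split : (∃₂ λ xs ys → z ∷ zs ≡ xs ++ ys × P xs ys) →
          P [] (z ∷ zs) ⊎ (∃₂ λ xs ys → zs ≡ xs ++ ys × P (z ∷ xs) ys)
  split ([]     , _  , refl , p) = inj₁ p
  split (x ∷ xs , ys , eq   , p) with refl , eq′ ← ∷-injective eq = inj₂ (xs , ys , eq′ , p)

-- Heights and Dyck words

-- The height reached by reading w as a lattice path from height h, or nothing if it goes below 0.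
height : ℕ → Word → Maybe ℕ
height h       []      = just h
height h       (u ∷ w) = height (suc h) w
height zero    (d ∷ w) = nothing
height (suc h) (d ∷ w) = height h w

Balanced : Word → Set
Balanced w = height 0 w ≡ just 0

Dyck : ℕ → Word → Set
Dyck n w = Balanced w × #u w ≡ n

balanced? : ∀ w → Dec (Balanced w)
balanced? w = ≡-dec _≟_ (height 0 w) (just 0)

height-++ : ∀ h xs ys → height h (xs ++ ys) ≡ (height h xs >>= λ t → height t ys)
height-++ h       []       ys = refl
height-++ h       (u ∷ xs) ys = height-++ (suc h) xs ys
height-++ zero    (d ∷ xs) ys = refl
height-++ (suc h) (d ∷ xs) ys = height-++ h xs ys

height-+ : ∀ k {h t} w → height h w ≡ just t → height (k + h) w ≡ just (k + t)
height-+ k             []      refl = refl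
height-+ k {h}     {t} (u ∷ w) eq   = subst (λ h′ → height h′ w ≡ just (k + t)) (+-suc k h) (height-+ k w eq)
height-+ k {suc h} {t} (d ∷ w) eq   =
  subst (λ h′ → height h′ (d ∷ w) ≡ just (k + t)) (sym (+-suc k h)) (height-+ k w eq)

balanced-at : ∀ h {w} → Balanced w → height h w ≡ just h
balanced-at h {w} bw = subst₂ (λ h′ t → height h′ w ≡ just t) (+-identityʳ h) (+-identityʳ h) (height-+ h w bw)

height-tunnel : ∀ h xs B ys → Balanced B → height h (xs ++ u ∷ B ++ d ∷ ys) ≡ height h (xs ++ ys)
height-tunnel h       []       B ys bB rewrite height-++ (suc h) B (d ∷ ys) | balanced-at (suc h) {B} bB = refl
height-tunnel h       (u ∷ xs) B ys bB = height-tunnel (suc h) xs B ys bB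
height-tunnel zero    (d ∷ xs) B ys bB = refl
height-tunnel (suc h) (d ∷ xs) B ys bB = height-tunnel h xs B ys bB

height-#u-#d : ∀ {h t} w → height h w ≡ just t → h + #u w ≡ t + #d w
height-#u-#d         []      refl = refl
height-#u-#d {h}     (u ∷ w) eq   = trans (+-suc h (#u w)) (height-#u-#d w eq)
height-#u-#d {suc h} (d ∷ w) eq   = trans (cong suc (height-#u-#d w eq)) (sym (+-suc _ (#d w)))

#u-++ : ∀ xs ys → #u (xs ++ ys) ≡ #u xs + #u ys
#u-++ []       ys = refl
#u-++ (u ∷ xs) ys = cong suc (#u-++ xs ys)
#u-++ (d ∷ xs) ys = #u-++ xs ys

length≡#u+#d : ∀ w → length w ≡ #u w + #d w
length≡#u+#d []      = refl
length≡#u+#d (u ∷ w) = cong suc (length≡#u+#d w)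
length≡#u+#d (d ∷ w) = trans (cong suc (length≡#u+#d w)) (sym (+-suc (#u w) (#d w)))

balanced⇒length≡2*#u : ∀ w → Balanced w → length w ≡ 2 * #u w
balanced⇒length≡2*#u w bw =
  trans (length≡#u+#d w) (cong (#u w +_) (trans (sym (height-#u-#d w bw)) (sym (+-identityʳ (#u w)))))

height⇒prefix-bound : ∀ {h t w} → height h w ≡ just t → ∀ p q → p ++ q ≡ w → #d p ≤ h + #u p
height⇒prefix-bound         _  []      _ _    = z≤n
height⇒prefix-bound {h}     eq (u ∷ p) q refl =
  subst (#d p ≤_) (sym (+-suc h (#u p))) (height⇒prefix-bound eq p q refl)
height⇒prefix-bound {zero}  () (d ∷ p) q refl
height⇒prefix-bound {suc h} eq (d ∷ p) q refl = s≤s (height⇒prefix-bound eq p q refl)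

prefix-bound⇒height : ∀ h w → (∀ p q → p ++ q ≡ w → #d p ≤ h + #u p) → ∃ λ t → height h w ≡ just t
prefix-bound⇒height h       []      _     = h , refl
prefix-bound⇒height h       (u ∷ w) bound =
  prefix-bound⇒height (suc h) w λ p q eq → subst (#d p ≤_) (+-suc h (#u p)) (bound (u ∷ p) q (cong (u ∷_) eq))
prefix-bound⇒height zero    (d ∷ w) bound with () ← bound (d ∷ []) w refl
prefix-bound⇒height (suc h) (d ∷ w) bound =
  prefix-bound⇒height h w λ p q eq → ≤-pred (bound (d ∷ p) q (cong (d ∷_) eq))

IsDyckOf⇔Dyck : ∀ {n w} → IsDyckOf n w ⇔ Dyck n w
IsDyckOf⇔Dyck {n} {w} = mk⇔ to from
  where
  to : IsDyckOf n w → Dyck n w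
  to (#u≡n , #d≡n , prefixOK) with t , eq ← prefix-bound⇒height 0 w prefixOK =
    subst (λ t → height 0 w ≡ just t) t≡0 eq , #u≡n
    where
    t≡0 : t ≡ 0
    t≡0 = +-cancelʳ-≡ n t 0 (trans (cong (t +_) (sym #d≡n)) (trans (sym (height-#u-#d w eq)) #u≡n))
  from : Dyck n w → IsDyckOf n w
  from (bw , #u≡n) = #u≡n , trans (sym (height-#u-#d w bw)) #u≡n , height⇒prefix-bound bw

IsDyck⇔Balanced : ∀ {w} → IsDyck w ⇔ Balanced w
IsDyck⇔Balanced {w} = mk⇔ (λ (_ , dyck) → proj₁ (Equivalence.to IsDyckOf⇔Dyck dyck))
                          (λ bw → #u w , Equivalence.from IsDyckOf⇔Dyck (bw , refl))

-- Counting Dyck words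

Path : ℕ → ℕ → Word → Set
Path m h w = length w ≡ m × height h w ≡ just 0

#paths : ℕ → ℕ → ℕ
#paths zero    zero    = 1
#paths zero    (suc h) = 0
#paths (suc m) zero    = #paths m 1
#paths (suc m) (suc h) = #paths m (suc (suc h)) + #paths m h

paths-card : ∀ m h → HasCard′ (Path m h) (#paths m h)
paths-card zero    zero    = HasCard′-resp-⇔ split (HasCard′-｛｝ [])
  where
  split : ∀ w → ｛ [] ｝ w ⇔ Path 0 0 w
  split []      = mk⇔ (λ _ → refl , refl) (λ _ → refl)
  split (_ ∷ _) = mk⇔ (λ ()) (λ ())
paths-card zero    (suc h) = HasCard′-resp-⇔ split HasCard′-∅
  where
  split : ∀ w → ∅ w ⇔ Path 0 (suc h) w
  split []      = mk⇔ (λ ()) (λ ())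
  split (_ ∷ _) = mk⇔ (λ ()) (λ ())
paths-card (suc m) zero    =
  HasCard′-resp-⇔ split (HasCard′-image (u ∷_) (λ _ _ → ∷-injectiveʳ) (paths-card m 1))
  where
  split : ∀ w → Image (u ∷_) (Path m 1) w ⇔ Path (suc m) 0 w
  split []      = mk⇔ (λ ()) (λ ())
  split (u ∷ w) = mk⇔ (λ { (_ , (l , e) , refl) → cong suc l , e }) (λ (l , e) → w , (suc-injective l , e) , refl)
  split (d ∷ w) = mk⇔ (λ ()) (λ ())
paths-card (suc m) (suc h) =
  HasCard′-resp-⇔ split
    (HasCard′-⊎ (λ { (_ , _ , refl) (_ , _ , ()) })
                (HasCard′-image (u ∷_) (λ _ _ → ∷-injectiveʳ) (paths-card m (suc (suc h))))
                (HasCard′-image (d ∷_) (λ _ _ → ∷-injectiveʳ) (paths-card m h)))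
  where
  split : ∀ w → (Image (u ∷_) (Path m (suc (suc h))) ∪ Image (d ∷_) (Path m h)) w ⇔ Path (suc m) (suc h) w
  split []      = mk⇔ (λ { (inj₁ (_ , _ , ())) ; (inj₂ (_ , _ , ())) }) (λ ())
  split (u ∷ w) = mk⇔ (λ { (inj₁ (_ , (l , e) , refl)) → cong suc l , e ; (inj₂ (_ , _ , ())) })
                      (λ (l , e) → inj₁ (w , (suc-injective l , e) , refl))
  split (d ∷ w) = mk⇔ (λ { (inj₁ (_ , _ , ())) ; (inj₂ (_ , (l , e) , refl)) → cong suc l , e })
                      (λ (l , e) → inj₂ (w , (suc-injective l , e) , refl))

choose-pascal : ∀ m k → suc m choose suc k ≡ m choose k + m choose suc k
choose-pascal m k = sym (nCk+nC[k+1]≡[n+1]C[k+1] m k)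

choose-absorption : ∀ m k → suc k * (suc m choose suc k) ≡ suc m * (m choose k)
choose-absorption zero    zero    = refl
choose-absorption zero    (suc k) = *-zeroʳ (suc (suc k))
choose-absorption (suc m) zero    = trans (+-identityʳ _) (trans (nC1≡n (suc (suc m))) (sym (*-identityʳ _)))
choose-absorption (suc m) (suc k) = begin
  suc (suc k) * (suc (suc m) choose suc (suc k))         ≡⟨ cong (suc (suc k) *_) (choose-pascal (suc m) (suc k)) ⟩
  suc (suc k) * (X + Y)                                  ≡⟨ trans (*-distribˡ-+ (suc (suc k)) X Y) (+-assoc X _ _) ⟩
  X + (suc k * X + suc (suc k) * Y)                      ≡⟨ cong (X +_) (cong₂ _+_ (choose-absorption m k)
                                                                                   (choose-absorption m (suc k))) ⟩
  X + (suc m * (m choose k) + suc m * (m choose suc k))  ≡⟨ cong (X +_) (sym (*-distribˡ-+ (suc m) (m choose k) _)) ⟩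
  X + suc m * (m choose k + m choose suc k)              ≡⟨ cong (λ z → X + suc m * z) (sym (choose-pascal m k)) ⟩
  suc (suc m) * X                                        ∎
  where
  open ≡-Reasoning
  X = suc m choose suc k
  Y = suc m choose suc (suc k)

choose-central : ∀ D → (D + suc D) choose D ≡ (D + suc D) choose suc D
choose-central D = trans (nCk≡nC[n∸k] (m≤m+n D (suc D))) (cong ((D + suc D) choose_) (m+n∸m≡n D (suc D)))

-- Reflection principle: D is the number of down-steps of a path of length m from height h to 0,
-- and the paths that dip below 0 correspond to all paths with D + 1 down-steps.
ballot : ∀ m h D → D + D ≡ m + h → #paths m h + m choose suc D ≡ m choose D
ballot zero    zero    zero    _  = refl
ballot zero    (suc h) (suc D) _  = refl
ballot (suc m) (suc h) (suc D) eq = begin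
  (P₂ + P₀) + suc m choose suc (suc D)  ≡⟨ cong ((P₂ + P₀) +_) (trans (choose-pascal m (suc D)) (+-comm Y Z)) ⟩
  (P₂ + P₀) + (Z + Y)                   ≡⟨ interchange P₂ P₀ Z Y ⟩
  (P₂ + Z) + (P₀ + Y)                   ≡⟨ cong₂ _+_ (ballot m (suc (suc h)) (suc D) eq₂) (ballot m h D eq₀) ⟩
  Y + X                                 ≡⟨ trans (+-comm Y X) (sym (choose-pascal m D)) ⟩
  suc m choose suc D                    ∎
  where
  open ≡-Reasoning
  P₂ = #paths m (suc (suc h))
  P₀ = #paths m h
  X = m choose D
  Y = m choose suc D
  Z = m choose suc (suc D)
  eq′ : D + suc D ≡ m + suc h
  eq′ = suc-injective eq
  eq₂ : suc D + suc D ≡ m + suc (suc h)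
  eq₂ = trans (cong suc eq′) (sym (+-suc m (suc h)))
  eq₀ : D + D ≡ m + h
  eq₀ = suc-injective (trans (sym (+-suc D D)) (trans eq′ (+-suc m h)))
ballot (suc m) zero    (suc D) eq = begin
  #paths m 1 + suc m choose suc (suc D)  ≡⟨ cong (#paths m 1 +_) (choose-pascal m (suc D)) ⟩
  #paths m 1 + (Y + Z)                   ≡⟨ x∙yz≈y∙xz (#paths m 1) Y Z ⟩
  Y + (#paths m 1 + Z)                   ≡⟨ cong (Y +_) (ballot m 1 (suc D) eq₁) ⟩
  Y + Y                                  ≡⟨ cong (_+ Y) (sym X≡Y) ⟩
  X + Y                                  ≡⟨ sym (choose-pascal m D) ⟩
  suc m choose suc D                     ∎
  where
  open ≡-Reasoning
  X = m choose D
  Y = m choose suc D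
  Z = m choose suc (suc D)
  eq₁ : suc D + suc D ≡ m + 1
  eq₁ = trans eq (trans (+-identityʳ (suc m)) (sym (+-comm m 1)))
  X≡Y : X ≡ Y
  X≡Y = subst (λ m → m choose D ≡ m choose suc D) (trans (suc-injective eq) (+-identityʳ m)) (choose-central D)

central-absorption : ∀ n → suc n * (2 * n choose suc n) ≡ n * (2 * n choose n)
central-absorption zero    = refl
central-absorption (suc n) = begin
  suc (suc n) * (suc m choose suc (suc n))  ≡⟨ choose-absorption m (suc n) ⟩
  suc m * (m choose suc n)                  ≡⟨ cong (suc m *_) (sym m-central) ⟩
  suc m * (m choose n)                      ≡⟨ sym (choose-absorption m n) ⟩
  suc n * (suc m choose suc n)              ∎
  where
  open ≡-Reasoning
  m = n + suc (n + 0)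
  m-central : m choose n ≡ m choose suc n
  m-central = subst (λ m → m choose n ≡ m choose suc n) (cong (λ z → n + suc z) (sym (+-identityʳ n)))
                    (choose-central n)

catalan≡#paths : ∀ n → catalan n ≡ #paths (2 * n) 0
catalan≡#paths n = begin
  catalan n            ≡⟨ cong (_/ suc n) (sym [n+1]*c≡C₀) ⟩
  (suc n * c) / suc n  ≡⟨ cong (_/ suc n) (*-comm (suc n) c) ⟩
  (c * suc n) / suc n  ≡⟨ m*n/n≡m c (suc n) ⟩
  c                    ∎
  where
  open ≡-Reasoning
  c  = #paths (2 * n) 0
  C₀ = 2 * n choose n
  C₁ = 2 * n choose suc n
  c+C₁≡C₀ : c + C₁ ≡ C₀
  c+C₁≡C₀ = ballot (2 * n) 0 n (trans (cong (n +_) (sym (+-identityʳ n))) (sym (+-identityʳ (2 * n))))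
  [n+1]*c≡C₀ : suc n * c ≡ C₀
  [n+1]*c≡C₀ = +-cancelʳ-≡ (n * C₀) (suc n * c) C₀ (begin
    suc n * c + n * C₀      ≡⟨ cong (suc n * c +_) (sym (central-absorption n)) ⟩
    suc n * c + suc n * C₁  ≡⟨ sym (*-distribˡ-+ (suc n) c C₁) ⟩
    suc n * (c + C₁)        ≡⟨ cong (suc n *_) c+C₁≡C₀ ⟩
    suc n * C₀              ∎)

Dyck⇔Path : ∀ {n w} → Dyck n w ⇔ Path (2 * n) 0 w
Dyck⇔Path {n} {w} = mk⇔ (λ (bw , #u≡n) → trans (balanced⇒length≡2*#u w bw) (cong (2 *_) #u≡n) , bw)
                        (λ (len , bw) → bw , *-cancelˡ-≡ (#u w) n 2 (trans (sym (balanced⇒length≡2*#u w bw)) len))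

dyck-card : ∀ n → HasCard′ (Dyck n) (catalan n)
dyck-card n = subst (HasCard′ (Dyck n)) (sym (catalan≡#paths n))
                    (HasCard′-resp-⇔ (λ w → ⇔-sym (Dyck⇔Path {n} {w})) (paths-card (2 * n) 0))

-- First returns

first-descent : ∀ j h w → height (j + suc h) w ≡ just 0 →
                ∃₂ λ x y → w ≡ x ++ d ∷ y × height j x ≡ just 0 × height h y ≡ just 0
first-descent j       h []      eq = contradiction (trans (sym (+-suc j h)) (just-injective eq)) 1+n≢0
first-descent j       h (u ∷ w) eq with x , y , refl , hx , hy ← first-descent (suc j) h w eq =
  u ∷ x , y , refl , hx , hy
first-descent zero    h (d ∷ w) eq = [] , w , refl , refl , eq
first-descent (suc j) h (d ∷ w) eq with x , y , refl , hx , hy ← first-descent j h w eq =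
  d ∷ x , y , refl , hx , hy

firstReturn : Word → Word → Word
firstReturn x y = u ∷ x ++ d ∷ y

first-return-split : ∀ {n} w → Dyck (suc n) w → Convolution (λ _ → firstReturn) Dyck Dyck n w
first-return-split     []      (_ , ())
first-return-split     (d ∷ w) (() , _)
first-return-split {n} (u ∷ w) (bw , #u≡) with x , y , refl , bx , by ← first-descent 0 0 w bw =
  #u x , subst (#u x ≤_) #ux+#uy≡n (m≤m+n (#u x) (#u y)) , (x , y) , ((bx , refl) , (by , #uy≡)) , refl
  where
  #ux+#uy≡n : #u x + #u y ≡ n
  #ux+#uy≡n = suc-injective (trans (cong suc (sym (#u-++ x (d ∷ y)))) #u≡)
  #uy≡ : #u y ≡ n ∸ #u x
  #uy≡ = trans (sym (m+n∸m≡n (#u x) (#u y))) (cong (_∸ #u x) #ux+#uy≡n)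

first-return-join : ∀ {n w} → Convolution (λ _ → firstReturn) Dyck Dyck n w → Dyck (suc n) w
first-return-join (_ , k≤n , (x , y) , ((bx , refl) , (by , #uy≡)) , refl) =
  trans (height-tunnel 0 [] x y bx) by ,
  cong suc (trans (#u-++ x (d ∷ y)) (trans (cong (#u x +_) #uy≡) (m+[n∸m]≡n k≤n)))

balanced-++-d∷ : ∀ x zs → Balanced x → height 0 (x ++ d ∷ zs) ≡ nothing
balanced-++-d∷ x zs bx rewrite height-++ 0 x (d ∷ zs) | bx = refl

balanced-prefix-unique≤ : ∀ x x′ {y y′} → Balanced x → Balanced x′ → x ++ d ∷ y ≡ x′ ++ d ∷ y′ →
                          length x ≤ length x′ → x ≡ x′ × y ≡ y′
balanced-prefix-unique≤ x x′ bx bx′ eq x≤x′ with ++-≡-++⁻ x _ x′ _ eq x≤x′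
... | []     , x′≡x++[] , d∷y≡d∷y′ = sym (trans x′≡x++[] (++-identityʳ x)) , ∷-injectiveʳ d∷y≡d∷y′
... | z ∷ zs , refl     , d∷y≡z∷zs′ with refl ← ∷-injectiveˡ d∷y≡z∷zs′ =
  contradiction (trans (sym (balanced-++-d∷ x zs bx)) bx′) λ ()

balanced-prefix-unique : ∀ x x′ {y y′} → Balanced x → Balanced x′ → x ++ d ∷ y ≡ x′ ++ d ∷ y′ →
                         x ≡ x′ × y ≡ y′
balanced-prefix-unique x x′ bx bx′ eq with ≤-total (length x) (length x′)
... | inj₁ x≤x′ = balanced-prefix-unique≤ x x′ bx bx′ eq x≤x′
... | inj₂ x′≤x = map₁ sym (map₂ sym (balanced-prefix-unique≤ x′ x bx′ bx (sym eq) x′≤x))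

catalan-convolution : ∀ n → catalan (suc n) ≡ (catalan ⋆ catalan) n
catalan-convolution n =
  HasCard′-unique (dyck-card (suc n))
    (HasCard′-resp-⇔ (λ w → mk⇔ first-return-join (first-return-split w))
      (HasCard′-⋆ (λ _ → firstReturn) n dyck-card dyck-card injective))
  where
  injective : ∀ {k l x y x′ y′} → Dyck k x → Dyck (n ∸ k) y → Dyck l x′ → Dyck (n ∸ l) y′ →
              firstReturn x y ≡ firstReturn x′ y′ → k ≡ l × x ≡ x′ × y ≡ y′
  injective {x = x} {x′ = x′} (bx , refl) _ (bx′ , refl) _ eq
    with refl , refl ← balanced-prefix-unique x x′ bx bx′ (∷-injectiveʳ eq) = refl , refl , refl

-- Centered tunnels

CenteredTunnel : Word → Word → Word → Word → Set
CenteredTunnel w A B C = w ≡ A ++ u ∷ B ++ d ∷ C × Balanced B × length A ≡ length C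

TunnelFree : Word → Set
TunnelFree w = ¬ HasCenteredTunnel w

HasCenteredTunnel⇔ : ∀ {w} → HasCenteredTunnel w ⇔ (∃ λ A → ∃₂ λ B C → CenteredTunnel w A B C)
HasCenteredTunnel⇔ =
  mk⇔ (λ (A , B , C , eq , dB , len) → A , B , C , eq , Equivalence.to IsDyck⇔Balanced dB , len)
      (λ (A , B , C , eq , bB , len) → A , B , C , eq , Equivalence.from IsDyck⇔Balanced bB , len)

centered-tunnel? : ∀ w → Dec (HasCenteredTunnel w)
centered-tunnel? w =
  map′ (from HasCenteredTunnel⇔ ∘ join) (split ∘ to HasCenteredTunnel⇔) (splits? tunnel-after? w)
  where
  open Equivalence
  TunnelAfter : Word → Word → Set
  TunnelAfter A R = ∃₂ λ B C → R ≡ u ∷ B ++ d ∷ C × Balanced B × length A ≡ length C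
  join : (∃₂ λ A R → w ≡ A ++ R × TunnelAfter A R) → ∃ λ A → ∃₂ λ B C → CenteredTunnel w A B C
  join (A , R , w≡A++R , B , C , R≡ , bB , len) = A , B , C , trans w≡A++R (cong (A ++_) R≡) , bB , len
  split : (∃ λ A → ∃₂ λ B C → CenteredTunnel w A B C) → ∃₂ λ A R → w ≡ A ++ R × TunnelAfter A R
  split (A , B , C , w≡ , bB , len) = A , u ∷ B ++ d ∷ C , w≡ , B , C , refl , bB , len
  tunnel-after? : ∀ A R → Dec (TunnelAfter A R)
  tunnel-after? A []      = no λ { (_ , _ , () , _) }
  tunnel-after? A (d ∷ R) = no λ { (_ , _ , () , _) }
  tunnel-after? A (u ∷ R) = map′ join′ split′ (splits? (λ B T → balanced? B ×-dec closes? T) R)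
    where
    Closes : Word → Set
    Closes T = ∃ λ C → T ≡ d ∷ C × length A ≡ length C
    closes? : ∀ T → Dec (Closes T)
    closes? []      = no λ { (_ , () , _) }
    closes? (u ∷ _) = no λ { (_ , () , _) }
    closes? (d ∷ C) = map′ (λ len → C , refl , len) (λ { (_ , refl , len) → len }) (length A ≟ length C)
    join′ : (∃₂ λ B T → R ≡ B ++ T × Balanced B × Closes T) → TunnelAfter A (u ∷ R)
    join′ (B , _ , R≡ , bB , C , refl , len) = B , C , cong (u ∷_) R≡ , bB , len
    split′ : TunnelAfter A (u ∷ R) → ∃₂ λ B T → R ≡ B ++ T × Balanced B × Closes T
    split′ (B , C , eq , bB , len) = B , d ∷ C , ∷-injectiveʳ eq , bB , C , refl , len

length-tunnel : ∀ A B C → length (A ++ u ∷ B ++ d ∷ C) ≡ length A + suc (length B + suc (length C))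
length-tunnel A B C = trans (length-++ A) (cong (λ n → length A + suc n) (length-++ B))

#u-tunnel : ∀ A B C → #u (A ++ u ∷ B ++ d ∷ C) ≡ suc (#u (A ++ C) + #u B)
#u-tunnel A B C = begin
  #u (A ++ u ∷ B ++ d ∷ C)      ≡⟨ #u-++ A _ ⟩
  #u A + suc (#u (B ++ d ∷ C))  ≡⟨ cong (λ n → #u A + suc n) (#u-++ B (d ∷ C)) ⟩
  #u A + suc (#u B + #u C)      ≡⟨ +-suc (#u A) _ ⟩
  suc (#u A + (#u B + #u C))    ≡⟨ cong suc (x∙yz≈xz∙y (#u A) (#u B) (#u C)) ⟩
  suc (#u A + #u C + #u B)      ≡⟨ cong (λ n → suc (n + #u B)) (sym (#u-++ A C)) ⟩
  suc (#u (A ++ C) + #u B)      ∎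
  where open ≡-Reasoning

tunnel-++ : ∀ P B Q R → (P ++ u ∷ B ++ d ∷ Q) ++ R ≡ P ++ u ∷ B ++ d ∷ Q ++ R
tunnel-++ P B Q R = trans (++-assoc P _ R) (cong (λ z → P ++ u ∷ z) (++-assoc B (d ∷ Q) R))

tunnel-encloses-middle : ∀ A B C A′ M C′ → A ++ u ∷ B ++ d ∷ C ≡ A′ ++ M ++ C′ →
                      length A < length A′ → length C < length C′ →
                      ∃₂ λ P Q → A′ ≡ A ++ u ∷ P × C′ ≡ Q ++ d ∷ C × B ≡ P ++ M ++ Q
tunnel-encloses-middle A B C A′ M C′ eq A<A′ C<C′
  with P , A′≡ , B++d∷C≡ ← ++-≡-++⁻ (A ∷ʳ u) (B ++ d ∷ C) A′ (M ++ C′) (trans (∷ʳ-++ A u _) eq)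
                                     (subst (_≤ length A′) (sym (trans (length-++ A) (+-comm (length A) 1))) A<A′)
  with Q , B≡ , C′≡ ← ++-≡-++⁻ʳ B (d ∷ C) (P ++ M) C′ (trans B++d∷C≡ (sym (++-assoc P M C′))) C<C′ =
  P , Q , trans A′≡ (∷ʳ-++ A u P) , C′≡ , trans B≡ (++-assoc P M Q)

double-< : ∀ {a b} m → a + a ≡ b + suc (m + suc b) → b < a
double-< {a} {b} m eq = ≰⇒> λ a≤b → <-irrefl eq (begin-strict
  a + a                ≤⟨ +-mono-≤ a≤b a≤b ⟩
  b + b                <⟨ +-monoʳ-< b (s≤s (≤-trans (n≤1+n b) (m≤n+m (suc b) m))) ⟩
  b + suc (m + suc b)  ∎)
  where open ≤-Reasoning

centered-tunnel-shorter : ∀ {A C A₂ B₂ C₂} → length A ≡ length C → A ++ C ≡ A₂ ++ u ∷ B₂ ++ d ∷ C₂ →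
                          length A₂ ≡ length C₂ → length A₂ < length A
centered-tunnel-shorter {A} {C} {A₂} {B₂} {C₂} A≡C A++C≡ A₂≡C₂ = double-< (length B₂) (begin
  length A + length A                            ≡⟨ cong (length A +_) A≡C ⟩
  length A + length C                            ≡⟨ sym (length-++ A) ⟩
  length (A ++ C)                                ≡⟨ cong length A++C≡ ⟩
  length (A₂ ++ u ∷ B₂ ++ d ∷ C₂)                ≡⟨ length-tunnel A₂ B₂ C₂ ⟩
  length A₂ + suc (length B₂ + suc (length C₂))  ≡⟨ cong (λ n → length A₂ + suc (length B₂ + suc n))
                                                         (sym A₂≡C₂) ⟩
  length A₂ + suc (length B₂ + suc (length A₂))  ∎)
  where open ≡-Reasoning

enclosing-tunnel : ∀ {w A B C A₂ B₂ C₂} → CenteredTunnel w A B C → CenteredTunnel (A ++ C) A₂ B₂ C₂ →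
                   length A₂ < length A × ∃ λ B′ → CenteredTunnel w A₂ B′ C₂
enclosing-tunnel {A = A} {B} {C} {A₂} {B₂} {C₂} (w≡ , bB , A≡C) (A++C≡ , bB₂ , A₂≡C₂)
  with A₂<A ← centered-tunnel-shorter {A} {C} A≡C A++C≡ A₂≡C₂
  with P , Q , refl , refl , refl ← tunnel-encloses-middle A₂ B₂ C₂ A [] C (sym A++C≡) A₂<A
                                                        (subst₂ _<_ A₂≡C₂ A≡C A₂<A) =
  A₂<A ,
  P ++ u ∷ B ++ d ∷ Q ,
  trans w≡ (trans (++-assoc A₂ (u ∷ P) _) (cong (λ z → A₂ ++ u ∷ z) (sym (tunnel-++ P B Q (d ∷ C₂))))) ,
  trans (height-tunnel 0 P B Q bB) bB₂ ,
  A₂≡C₂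

outermost-tunnel : ∀ {w A B C} → CenteredTunnel w A B C →
                   ∃ λ A′ → ∃₂ λ B′ C′ → CenteredTunnel w A′ B′ C′ × TunnelFree (A′ ++ C′)
outermost-tunnel {A = A} t = go t (<-wellFounded (length A))
  where
  go : ∀ {w A B C} → CenteredTunnel w A B C → Acc _<_ (length A) →
       ∃ λ A′ → ∃₂ λ B′ C′ → CenteredTunnel w A′ B′ C′ × TunnelFree (A′ ++ C′)
  go {A = A} {B} {C} t (acc rec) with centered-tunnel? (A ++ C)
  ... | no tunnelFree = A , B , C , t , tunnelFree
  ... | yes hasTunnel with _ , _ , _ , t₂ ← Equivalence.to HasCenteredTunnel⇔ hasTunnel
                      with shorter , _ , t′ ← enclosing-tunnel t t₂ = go t′ (rec shorter)

-- Centered tunnels are nested: cutting the inner tunnel out of the outer one leaves a centered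
-- tunnel of A′ ++ C′.
outside-has-tunnel : ∀ {w A B C A′ B′ C′} → CenteredTunnel w A B C → CenteredTunnel w A′ B′ C′ →
                     length A < length A′ → HasCenteredTunnel (A′ ++ C′)
outside-has-tunnel {A = A} {B} {C} {A′} {B′} {C′} (w≡ , bB , A≡C) (w≡′ , bB′ , A′≡C′) A<A′
  with tunnel-encloses-middle A B C A′ (u ∷ B′ ++ [ d ]) C′ eq A<A′ (subst₂ _<_ A≡C A′≡C′ A<A′)
  where
  eq : A ++ u ∷ B ++ d ∷ C ≡ A′ ++ (u ∷ B′ ++ [ d ]) ++ C′
  eq = trans (sym w≡) (trans w≡′ (cong (λ z → A′ ++ u ∷ z) (sym (++-assoc B′ [ d ] C′))))
... | P , Q , refl , refl , refl = Equivalence.from HasCenteredTunnel⇔ (A , P ++ Q , C , A′++C′≡ , bPQ , A≡C)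
  where
  A′++C′≡ : (A ++ u ∷ P) ++ Q ++ d ∷ C ≡ A ++ u ∷ (P ++ Q) ++ d ∷ C
  A′++C′≡ = trans (++-assoc A (u ∷ P) _) (cong (λ z → A ++ u ∷ z) (sym (++-assoc P Q (d ∷ C))))
  bPQ : Balanced (P ++ Q)
  bPQ = trans (sym (height-tunnel 0 P B′ Q bB′))
              (trans (cong (λ z → height 0 (P ++ u ∷ z)) (sym (++-assoc B′ [ d ] Q))) bB)

outermost-tunnel-unique : ∀ {w A B C A′ B′ C′} → CenteredTunnel w A B C → CenteredTunnel w A′ B′ C′ →
                          TunnelFree (A ++ C) → TunnelFree (A′ ++ C′) → A ≡ A′ × B ≡ B′ × C ≡ C′
outermost-tunnel-unique {A = A} {B} {A′ = A′} {B′} t@(w≡ , bB , _) t′@(w≡′ , bB′ , _) free free′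
  with <-cmp (length A) (length A′)
... | tri< A<A′ _ _ = contradiction (outside-has-tunnel t t′ A<A′) free′
... | tri> _ _ A′<A = contradiction (outside-has-tunnel t′ t A′<A) free
... | tri≈ _ A≡A′ _ with refl , rest ← ++-≡-++-same-length A _ A′ _ (trans (sym w≡) w≡′) A≡A′
                    with refl , refl ← balanced-prefix-unique B B′ bB bB′ (∷-injectiveʳ rest) = refl , refl , refl

TunnelFreeDyck : ℕ → Word → Set
TunnelFreeDyck n = Dyck n ∩ TunnelFree

-- For x of semilength k, take k x and drop k x are its two halves.
insertTunnel : ℕ → Word → Word → Word
insertTunnel k x y = take k x ++ u ∷ y ++ d ∷ drop k x

dyck-halves : ∀ {k x} → Dyck k x → length (take k x) ≡ k × length (drop k x) ≡ k
dyck-halves {k} {x} (bx , #ux≡k) =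
  trans (length-take k x) (trans (cong (k ⊓_) |x|) (m≤n⇒m⊓n≡m (m≤m+n k k))) ,
  trans (length-drop k x) (trans (cong (_∸ k) |x|) (m+n∸m≡n k k))
  where
  |x| : length x ≡ k + k
  |x| = trans (balanced⇒length≡2*#u x bx) (trans (cong (2 *_) #ux≡k) (cong (k +_) (+-identityʳ k)))

insertTunnel-centered : ∀ {k x y} → Dyck k x → Balanced y →
                        CenteredTunnel (insertTunnel k x y) (take k x) y (drop k x)
insertTunnel-centered dx by = let |take| , |drop| = dyck-halves dx in refl , by , trans |take| (sym |drop|)

tunnel-removal : ∀ {n w A B C} → Dyck (suc n) w → CenteredTunnel w A B C → TunnelFree (A ++ C) →
                 Convolution insertTunnel TunnelFreeDyck Dyck n w
tunnel-removal {n} {w} {A} {B} {C} (bw , #u≡) (w≡ , bB , A≡C) free =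
  k , k≤n , (A ++ C , B) , (((bx , #ux≡k) , free) , (bB , #uB≡)) , sym w≡insert
  where
  k = length A
  bx : Balanced (A ++ C)
  bx = trans (sym (height-tunnel 0 A B C bB)) (trans (cong (height 0) (sym w≡)) bw)
  #u-sum : #u (A ++ C) + #u B ≡ n
  #u-sum = suc-injective (trans (sym (#u-tunnel A B C)) (trans (cong #u (sym w≡)) #u≡))
  #ux≡k : #u (A ++ C) ≡ k
  #ux≡k = *-cancelˡ-≡ _ k 2 (begin
    2 * #u (A ++ C)      ≡⟨ sym (balanced⇒length≡2*#u (A ++ C) bx) ⟩
    length (A ++ C)      ≡⟨ length-++ A ⟩
    length A + length C  ≡⟨ cong (k +_) (trans (sym A≡C) (sym (+-identityʳ k))) ⟩
    2 * k                ∎)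
    where open ≡-Reasoning
  k≤n : k ≤ n
  k≤n = subst₂ _≤_ #ux≡k #u-sum (m≤m+n (#u (A ++ C)) (#u B))
  #uB≡ : #u B ≡ n ∸ k
  #uB≡ = trans (sym (m+n∸m≡n (#u (A ++ C)) (#u B))) (cong₂ _∸_ #u-sum #ux≡k)
  w≡insert : w ≡ insertTunnel k (A ++ C) B
  w≡insert = trans w≡ (cong₂ (λ A C → A ++ u ∷ B ++ d ∷ C)
                             (sym (take-length-++ A C)) (sym (drop-length-++ A C)))

tunnel-split : ∀ {n} w → Dyck (suc n) w × HasCenteredTunnel w → Convolution insertTunnel TunnelFreeDyck Dyck n w
tunnel-split w (dw , hasTunnel)
  with _ , _ , _ , t ← Equivalence.to HasCenteredTunnel⇔ hasTunnel
  with _ , _ , _ , t′ , free ← outermost-tunnel t = tunnel-removal dw t′ free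

tunnel-join : ∀ {n w} → Convolution insertTunnel TunnelFreeDyck Dyck n w → Dyck (suc n) w × HasCenteredTunnel w
tunnel-join (k , k≤n , (x , y) , ((dx@(bx , #ux≡k) , _) , (by , #uy≡)) , refl) =
  (trans (height-tunnel 0 (take k x) y (drop k x) by) (trans (cong (height 0) (take++drop≡id k x)) bx) ,
   trans (#u-tunnel (take k x) y (drop k x))
         (cong suc (trans (cong₂ _+_ (trans (cong #u (take++drop≡id k x)) #ux≡k) #uy≡) (m+[n∸m]≡n k≤n)))) ,
  Equivalence.from HasCenteredTunnel⇔ (_ , _ , _ , insertTunnel-centered dx by)

insertTunnel-injective : ∀ {n k l x y x′ y′} → TunnelFreeDyck k x → Dyck (n ∸ k) y →
                         TunnelFreeDyck l x′ → Dyck (n ∸ l) y′ →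
                         insertTunnel k x y ≡ insertTunnel l x′ y′ → k ≡ l × x ≡ x′ × y ≡ y′
insertTunnel-injective {k = k} {l} {x} {x′ = x′} (dx , free) (by , _) (dx′ , free′) (by′ , _) eq
  with take≡ , refl , drop≡ ← outermost-tunnel-unique (insertTunnel-centered dx by)
                                (subst (λ w → CenteredTunnel w _ _ _) (sym eq) (insertTunnel-centered dx′ by′))
                                (subst TunnelFree (sym (take++drop≡id k x)) free)
                                (subst TunnelFree (sym (take++drop≡id l x′)) free′) =
  trans (sym (proj₁ (dyck-halves dx))) (trans (cong length take≡) (proj₁ (dyck-halves dx′))) ,
  trans (sym (take++drop≡id k x)) (trans (cong₂ _++_ take≡ drop≡) (take++drop≡id l x′)) ,
  refl

-- Opaque, so that comparing these numbers with literals never makes the type checker evaluate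
-- the enumeration behind them.
opaque
  #tunnelFree : ℕ → ℕ
  #tunnelFree n = proj₁ (HasCard′-∩ (¬? ∘ centered-tunnel?) (dyck-card n))

  tunnelFree-card : ∀ n → HasCard′ (TunnelFreeDyck n) (#tunnelFree n)
  tunnelFree-card n = proj₂ (HasCard′-∩ (¬? ∘ centered-tunnel?) (dyck-card n))

tunnel-convolution : ∀ n → catalan (suc n) ≡ #tunnelFree (suc n) + (#tunnelFree ⋆ catalan) n
tunnel-convolution n =
  HasCard′-unique (dyck-card (suc n))
    (HasCard′-resp-⇔ (λ w → mk⇔ (λ { (inj₁ (dw , _)) → dw ; (inj₂ c) → proj₁ (tunnel-join c) })
                                (by-tunnel w))
      (HasCard′-⊎ (λ (_ , free) → free ∘ proj₂ ∘ tunnel-join {n})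
                  (tunnelFree-card (suc n))
                  (HasCard′-⋆ insertTunnel n tunnelFree-card dyck-card insertTunnel-injective)))
  where
  by-tunnel : ∀ w → Dyck (suc n) w → (TunnelFreeDyck (suc n) ∪ Convolution insertTunnel TunnelFreeDyck Dyck n) w
  by-tunnel w dw with centered-tunnel? w
  ... | no free       = inj₁ (dw , free)
  ... | yes hasTunnel = inj₂ (tunnel-split w (dw , hasTunnel))

tunnel⇒#u≢0 : ∀ {w} → HasCenteredTunnel w → #u w ≢ 0
tunnel⇒#u≢0 (A , B , C , refl , _) #u≡0 = 1+n≢0 (trans (sym (#u-tunnel A B C)) #u≡0)

#tunnelFree-0 : #tunnelFree 0 ≡ 1
#tunnelFree-0 =
  HasCard′-unique (tunnelFree-card 0)
    (HasCard′-resp-⇔ (λ w → mk⇔ (λ dw → dw , λ hasTunnel → tunnel⇒#u≢0 hasTunnel (proj₂ dw)) proj₁)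
                     (dyck-card 0))

IsFine-#tunnelFree : IsFine #tunnelFree
IsFine-#tunnelFree = g₁≡0 , g₂≡1 , fine ∘ suc
  where
  fine : ∀ n → catalan (suc n) ≡ 2 * #tunnelFree (suc n) + #tunnelFree n
  fine = fine-recurrence {catalan} {#tunnelFree} refl #tunnelFree-0 catalan-convolution tunnel-convolution
  g₁≡0 : #tunnelFree 1 ≡ 0
  g₁≡0 = *-cancelˡ-≡ _ 0 2 (+-cancelʳ-≡ 1 _ 0
           (trans (cong (2 * #tunnelFree 1 +_) (sym #tunnelFree-0)) (sym (fine 0))))
  g₂≡1 : #tunnelFree 2 ≡ 1
  g₂≡1 = *-cancelˡ-≡ _ 1 2
           (trans (sym (+-identityʳ _)) (trans (cong (2 * #tunnelFree 2 +_) (sym g₁≡0)) (sym (fine 1))))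

corollary1 : (F : ℕ → ℕ) → IsFine F → (n : ℕ) → 1 ≤ n →
    HasCard (λ D → IsDyckOf n D × ¬ HasCenteredTunnel D) (F n)
corollary1 F isFine (suc m) _ =
  subst (HasCard _) (IsFine-unique {#tunnelFree} {F} IsFine-#tunnelFree isFine m)
    (HasCard′-resp-⇔ (λ w → mk⇔ (λ (dw , free) → Equivalence.from IsDyckOf⇔Dyck dw , free)
                                 (λ (dw , free) → Equivalence.to IsDyckOf⇔Dyck dw , free))
                     (tunnelFree-card (suc m)))
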